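{- Working in $\mathsf{ZF}$: from an infinite ordinal $\alpha$, one can explicitly define an injection $f:\mathcal{P}(\alpha)\to\mathcal{P}_{\infty}(\alpha)$. That is, there is a class function $F$, definable without parameters, such that for every infinite ordinal $\alpha$, $F(\alpha)$ is an injection from $\mathcal{P}(\alpha)$ into $\mathcal{P}_{\infty}(\alpha)$.
   Context: $\mathcal{P}(A)$ is the power set of $A$ and $\mathcal{P}_{\infty}(A)$ is the set of all infinite subsets of $A$. The ambient theory is $\mathsf{ZF}$ without the axiom of choice. "One can explicitly define" means via a class function without free variables (parameters) applying uniformly to all inputs satisfying the hypotheses. -}

module Defs where

open import Level using (0ℓ)
open import Data.Nat using (ℕ)
open import Data.Fin using (Fin)
open import Data.Product using (Σ; _×_; proj₁)
open import Data.Sum using (_⊎_)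
open import Relation.Nullary using (¬_)
open import Relation.Binary.PropositionalEquality using (_≡_)
open import Relation.Binary.Definitions using (Transitive; Trichotomous)
open import Induction.WellFounded using (WellFounded)
open import Function.Bundles using (_↔_)

isProp : Set → Set
isProp A = (x y : A) → x ≡ y

isSet : Set → Set
isSet A = (x y : A) → isProp (x ≡ y)

-- The ambient logic of ZF is classical: excluded middle for propositions.
-- (Only for mere propositions, so it does NOT yield any form of choice.)
LEM : Set₁
LEM = (P : Set) → isProp P → P ⊎ ¬ P

-- An ordinal, represented (up to the canonical isomorphism) as a
-- well-ordered set: a set with a proposition-valued, transitive,
-- trichotomous, well-founded strict order.
record Ordinal : Set₁ where
  field
    Carrier   : Set
    carrier-set : isSet Carrier
    _<_       : Carrier → Carrier → Set
    <-prop    : ∀ x y → isProp (x < y)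
    <-trans   : Transitive _<_
    <-tri     : Trichotomous _≡_ _<_
    <-wf      : WellFounded _<_

open Ordinal public

-- Finite / infinite sets (Dedekind-free, standard ZF meaning:
-- finite = in bijection with some n = {0,…,n-1}).
Finite : Set → Set
Finite A = Σ ℕ λ n → A ↔ Fin n

Infinite : Set → Set
Infinite A = ¬ Finite A

Prop : Set₁
Prop = Σ Set isProp

Subset : Set → Set₁
Subset A = A → Prop

_∈_ : {A : Set} → A → Subset A → Set
x ∈ S = proj₁ (S x)

Elems : {A : Set} → Subset A → Set
Elems {A} S = Σ A λ x → x ∈ S

_≐_ : {A : Set} → Subset A → Subset A → Set
_≐_ {A} S T = ∀ (x : A) → (x ∈ S → x ∈ T) × (x ∈ T → x ∈ S)

-- f : 𝒫(A) → 𝒫_∞(A) is an injection: well-defined on 𝒫(A),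
-- lands in the infinite subsets, and is injective.
IsInjectionIntoInfinite : {A : Set} → (Subset A → Subset A) → Set₁
IsInjectionIntoInfinite {A} f =
  (∀ S T → S ≐ T → f S ≐ f T) ×
  (∀ S → Infinite (Elems (f S))) ×
  (∀ S T → f S ≐ f T → S ≐ T)

-- Enumerate the first ω elements of α as x₀ < x₁ < x₂ < … (each xₙ is definable
-- as the n-th element, so no choice is involved) and send S to
--   { x₂ₙ₊₁ | n ∈ ℕ } ∪ { x₂ₙ | xₙ ∈ S } ∪ (S ∖ {xₙ | n ∈ ℕ}).
-- The odd-indexed elements make the image infinite, and S is recovered from its
-- image: the part of S among the xₙ from the even indices, the rest verbatim.
-- Constructively the xₙ only exist up to double negation, which suffices because
-- excluded middle makes membership in a subset ¬¬-stable.
module Submission where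

open import Defs hiding (_<_)
open import Data.Empty using (⊥; ⊥-elim; ⊥-elim-irr)
open import Data.Fin using (Fin; zero; suc; toℕ; fromℕ<)
open import Data.Fin.Properties using (toℕ-injective; toℕ-fromℕ<; toℕ≤pred[n]; injective⇒≤)
open import Data.Irrelevant using (Irrelevant; [_])
open import Data.Nat using (ℕ; zero; suc; _*_; _≤_; _<_; s≤s)
open import Data.Nat.Properties using (suc-injective; *-cancelˡ-≡; even≢odd; 1+n≰n; n<1+n; m<n⇒m<1+n; m≤n⇒m<n∨m≡n)
open import Data.Product using (Σ; _×_; _,_; proj₁; proj₂)
open import Data.Sum using (inj₁; inj₂)
open import Data.Unit using (⊤; tt)
open import Function using (_∘_)
open import Function.Bundles using (Injection; mk↔ₛ′)
open import Function.Properties.Inverse using (↔⇒↣)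
open import Induction.WellFounded using (WellFounded; Acc; acc)
open import Relation.Binary.Definitions using (Trichotomous; tri<; tri≈; tri>)
open import Relation.Binary.PropositionalEquality using (_≡_; refl; trans; cong; subst)
open import Relation.Nullary using (¬_; Dec; yes; no)
open import Relation.Nullary.Decidable using (¬¬-excluded-middle)
open import Relation.Nullary.Negation using (¬¬-map)

¬¬-Π-Fin : ∀ {n} {P : Fin n → Set} → (∀ i → ¬ ¬ P i) → ¬ ¬ (∀ i → P i)
¬¬-Π-Fin {zero}  ¬¬P ¬Π = ¬Π (λ ())
¬¬-Π-Fin {suc n} ¬¬P ¬Π = ¬¬P zero λ P₀ → ¬¬-Π-Fin (¬¬P ∘ suc) λ Pₛ →
  ¬Π λ { zero → P₀ ; (suc i) → Pₛ i }

Irrelevant⇒¬¬ : {A : Set} → Irrelevant A → ¬ ¬ A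
Irrelevant⇒¬¬ [ a ] ¬a = ⊥-elim-irr (¬a a)

∈-stable : LEM → {A : Set} (S : Subset A) (x : A) → ¬ ¬ x ∈ S → x ∈ S
∈-stable lem S x ¬¬x∈S with lem (proj₁ (S x)) (proj₂ (S x))
... | inj₁ x∈S = x∈S
... | inj₂ x∉S = ⊥-elim (¬¬x∈S x∉S)

ranked⇒infinite : {A : Set} (R : ℕ → A → Set) →
                  (∀ {m n a} → R m a → R n a → m ≡ n) →
                  (∀ n → ¬ ¬ Σ A (R n)) → Infinite A
ranked⇒infinite {A} R R-injective R-exists (k , A↔k) =
  ¬¬-Π-Fin (R-exists ∘ toℕ) λ pick → 1+n≰n (injective⇒≤ (pick-injective pick))
  where
  open Injection (↔⇒↣ A↔k) using (to; injective)
  pick-injective : (pick : ∀ (i : Fin (suc k)) → Σ A (R (toℕ i))) →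
                   ∀ {i j} → to (proj₁ (pick i)) ≡ to (proj₁ (pick j)) → i ≡ j
  pick-injective pick {i} {j} eq = toℕ-injective
    (R-injective (subst (R (toℕ i)) (injective eq) (proj₂ (pick i))) (proj₂ (pick j)))

module Rank {C : Set} (_≺_ : C → C → Set) (≺-tri : Trichotomous _≡_ _≺_) where

  Minimal : (C → Set) → C → Set
  Minimal P x = P x × (∀ y → P y → ¬ y ≺ x)

  minimal-unique : ∀ {P x y} → Minimal P x → Minimal P y → x ≡ y
  minimal-unique {x = x} {y} (Px , x-min) (Py , y-min) with ≺-tri x y
  ... | tri< x≺y _ _ = ⊥-elim (y-min x Px x≺y)
  ... | tri≈ _ x≡y _ = x≡y
  ... | tri> _ _ y≺x = ⊥-elim (x-min y Py y≺x)

  predecessor-unique : ∀ {p q x} → Minimal (p ≺_) x → Minimal (q ≺_) x → p ≡ q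
  predecessor-unique {p} {q} (p≺x , x-min) (q≺x , x-min′) with ≺-tri p q
  ... | tri< p≺q _ _ = ⊥-elim (x-min q p≺q q≺x)
  ... | tri≈ _ p≡q _ = p≡q
  ... | tri> _ _ q≺p = ⊥-elim (x-min′ p q≺p p≺x)

  data Nth : ℕ → C → Set where
    least : ∀ {x} → Minimal (λ _ → ⊤) x → Nth zero x
    next  : ∀ {n p x} → Nth n p → Minimal (p ≺_) x → Nth (suc n) x

  Nth-functional : ∀ {n x y} → Nth n x → Nth n y → x ≡ y
  Nth-functional (least x-min) (least y-min) = minimal-unique x-min y-min
  Nth-functional (next p x-min) (next q y-min) with Nth-functional p q
  ... | refl = minimal-unique x-min y-min

  Nth-injective : ∀ {m n x} → Nth m x → Nth n x → m ≡ n
  Nth-injective (least _) (least _) = refl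
  Nth-injective (least (_ , x-min)) (next {p = q} _ (q≺x , _)) = ⊥-elim (x-min q tt q≺x)
  Nth-injective (next {p = p} _ (p≺x , _)) (least (_ , x-min)) = ⊥-elim (x-min p tt p≺x)
  Nth-injective (next p x-min) (next q x-min′) with predecessor-unique x-min x-min′
  ... | refl = cong suc (Nth-injective p q)

  Nth-≤ : ∀ {m n x} → Nth n x → m ≤ n → Σ C (Nth m)
  Nth-≤ r m≤n with m≤n⇒m<n∨m≡n m≤n
  Nth-≤ r          _ | inj₂ refl      = _ , r
  Nth-≤ (next r _) _ | inj₁ (s≤s m≤n) = Nth-≤ r m≤n

  Nth-below : ∀ {n x y} → Nth n x → y ≺ x → Σ ℕ λ m → m < n × Nth m y
  Nth-below {y = y} (least (_ , x-min)) y≺x = ⊥-elim (x-min y tt y≺x)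
  Nth-below {y = y} (next {p = p} r (p≺x , x-min)) y≺x with ≺-tri y p
  ... | tri< y≺p _ _ = let m , m<n , s = Nth-below r y≺p in m , m<n⇒m<1+n m<n , s
  ... | tri≈ _ refl _ = _ , n<1+n _ , r
  ... | tri> _ _ p≺y = ⊥-elim (x-min y p≺y y≺x)

  maximum⇒finite : ∀ {n x} → Nth n x → (∀ y → ¬ x ≺ y) → Finite C
  maximum⇒finite {n} {x} r x-max = suc n , mk↔ₛ′ to from to∘from from∘to
    where
    rank : ∀ y → Σ ℕ λ m → m < suc n × Nth m y
    rank y with ≺-tri y x
    ... | tri< y≺x _ _ = let m , m<n , s = Nth-below r y≺x in m , m<n⇒m<1+n m<n , s
    ... | tri≈ _ refl _ = n , n<1+n n , r
    ... | tri> _ _ x≺y = ⊥-elim (x-max y x≺y)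

    to : C → Fin (suc n)
    to y = fromℕ< (proj₁ (proj₂ (rank y)))

    element : (i : Fin (suc n)) → Σ C (Nth (toℕ i))
    element i = Nth-≤ r (toℕ≤pred[n] i)

    from : Fin (suc n) → C
    from = proj₁ ∘ element

    to∘from : ∀ i → to (from i) ≡ i
    to∘from i = toℕ-injective (trans (toℕ-fromℕ< _)
      (Nth-injective (proj₂ (proj₂ (rank (from i)))) (proj₂ (element i))))

    from∘to : ∀ y → from (to y) ≡ y
    from∘to y = Nth-functional
      (subst (λ m → Nth m (from (to y))) (toℕ-fromℕ< _) (proj₂ (element (to y))))
      (proj₂ (proj₂ (rank y)))

  module _ (≺-wf : WellFounded _≺_) where

    no-minimal⇒empty : ∀ P → ¬ Σ C (Minimal P) → ∀ x → ¬ P x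
    no-minimal⇒empty P no-min x = go x (≺-wf x)
      where
      go : ∀ x → Acc _≺_ x → ¬ P x
      go x (acc rs) Px = no-min (x , Px , λ y Py y≺x → go y (rs y≺x) Py)

    Nth-exists : Infinite C → ∀ n → ¬ ¬ Σ C (Nth n)
    Nth-exists inf zero ¬least = inf (0 , mk↔ₛ′ (⊥-elim ∘ empty) (λ ()) (λ ()) (⊥-elim ∘ empty))
      where
      empty : C → ⊥
      empty x = no-minimal⇒empty (λ _ → ⊤) (λ (x , x-min) → ¬least (x , least x-min)) x tt
    Nth-exists inf (suc n) ¬next = Nth-exists inf n λ (p , r) →
      inf (maximum⇒finite r (no-minimal⇒empty (p ≺_) (λ (x , x-min) → ¬next (x , next r x-min))))

module Encoding (α : Ordinal) where

  open Rank (Ordinal._<_ α) (<-tri α)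

  HasFiniteRank : Carrier α → Set
  HasFiniteRank x = Σ ℕ λ n → Nth n x

  data Encodes (S : Subset (Carrier α)) (x : Carrier α) : Set where
    odd-rank  : ∀ n → Nth (suc (2 * n)) x → Encodes S x
    even-rank : ∀ {n y} → Nth (2 * n) x → Nth n y → y ∈ S → Encodes S x
    beyond-ω  : ¬ HasFiniteRank x → x ∈ S → Encodes S x

  encode : Subset (Carrier α) → Subset (Carrier α)
  encode S x = Irrelevant (Encodes S x) , λ { [ _ ] [ _ ] → refl }

  Encodes-mono : ∀ {S T} → (∀ y → y ∈ S → y ∈ T) → ∀ {x} → Encodes S x → Encodes T x
  Encodes-mono S⊆T (odd-rank n r)      = odd-rank n r
  Encodes-mono S⊆T (even-rank r s y∈S) = even-rank r s (S⊆T _ y∈S)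
  Encodes-mono S⊆T (beyond-ω ¬r x∈S)   = beyond-ω ¬r (S⊆T _ x∈S)

  encode-cong : ∀ S T → S ≐ T → encode S ≐ encode T
  encode-cong S T S≐T x = (λ { [ e ] → [ Encodes-mono (proj₁ ∘ S≐T) e ] })
                        , (λ { [ e ] → [ Encodes-mono (proj₂ ∘ S≐T) e ] })

  decode-even-rank : ∀ {S n x z} → Nth n x → Nth (2 * n) z → Encodes S z → x ∈ S
  decode-even-rank {n = n} r s (odd-rank m s′) = ⊥-elim (even≢odd n m (Nth-injective s s′))
  decode-even-rank {S} {n} r s (even-rank {m} s′ r′ y∈S)
    with *-cancelˡ-≡ m n 2 (Nth-injective s′ s)
  ... | refl = subst (_∈ S) (Nth-functional r′ r) y∈S
  decode-even-rank r s (beyond-ω ¬r _) = ⊥-elim (¬r (_ , s))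

  decode-beyond-ω : ∀ {S x} → ¬ HasFiniteRank x → Encodes S x → x ∈ S
  decode-beyond-ω ¬r (odd-rank _ s)    = ⊥-elim (¬r (_ , s))
  decode-beyond-ω ¬r (even-rank s _ _) = ⊥-elim (¬r (_ , s))
  decode-beyond-ω ¬r (beyond-ω _ x∈S)  = x∈S

  module _ (inf : Infinite (Carrier α)) where

    encode-infinite : ∀ S → Infinite (Elems (encode S))
    encode-infinite S = ranked⇒infinite (λ n a → Nth (suc (2 * n)) (proj₁ a))
      (λ r s → *-cancelˡ-≡ _ _ 2 (suc-injective (Nth-injective r s)))
      (λ n → ¬¬-map (λ (x , r) → (x , [ odd-rank n r ]) , r) (Nth-exists (<-wf α) inf (suc (2 * n))))

    encode-reflects-⊆ : LEM → ∀ S T → (∀ x → x ∈ encode S → x ∈ encode T) →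
                        ∀ x → x ∈ S → x ∈ T
    encode-reflects-⊆ lem S T encS⊆encT x x∈S =
      ∈-stable lem T x λ x∉T → ¬¬-excluded-middle (refute x∉T)
      where
      refute : ¬ x ∈ T → ¬ Dec (HasFiniteRank x)
      refute x∉T (yes (n , r)) = Nth-exists (<-wf α) inf (2 * n) λ (z , s) →
        Irrelevant⇒¬¬ (encS⊆encT z [ even-rank s r x∈S ]) (x∉T ∘ decode-even-rank r s)
      refute x∉T (no ¬r) =
        Irrelevant⇒¬¬ (encS⊆encT x [ beyond-ω ¬r x∈S ]) (x∉T ∘ decode-beyond-ω ¬r)

lemma4p1 : LEM →
    Σ ((α : Ordinal) → Subset (Carrier α) → Subset (Carrier α)) λ F →
    (α : Ordinal) → Infinite (Carrier α) → IsInjectionIntoInfinite (F α)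
lemma4p1 lem = Encoding.encode , λ α inf →
  let open Encoding α in
    encode-cong
  , encode-infinite inf
  , λ S T encS≐encT x → encode-reflects-⊆ inf lem S T (proj₁ ∘ encS≐encT) x
                      , encode-reflects-⊆ inf lem T S (proj₂ ∘ encS≐encT) x
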